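{- Let $n\ge 2$ and let $\sigma\in D_n$ be a good chessboard element, with parabolic factorization $\sigma=\sigma^{[n-1]}\sigma_{[n-1]}$, $\sigma^{[n-1]}\in T_n$, $\sigma_{[n-1]}\in S_n$. Then \[ \mathrm{oinv}(\sigma)=\mathrm{oinv}(\sigma^{[n-1]})+\mathrm{oinv}(\sigma_{[n-1]}) \quad\text{and}\quad \mathrm{onsp}(\sigma)=\mathrm{onsp}(\sigma^{[n-1]})+\mathrm{onsp}(\sigma_{[n-1]}). \]
   Context: $D_n$ is the group of signed permutations $\sigma$ of $[n]$ (bijections of $\{\pm1,\dots,\pm n\}$ with $\sigma(-i)=-\sigma(i)$) with an even number of negative entries in the window $[\sigma(1),\dots,\sigma(n)]$; products are compositions, $(uv)(i)=u(v(i))$. $S_n\subseteq D_n$ is the subgroup of permutations of $[n]$ (no negative entries). $T_n=\{\tau\in D_n:\tau(1)<\tau(2)<\dots<\tau(n)\}$ (elements with no descents in $[n-1]$). Every $\sigma\in D_n$ factors uniquely as $\sigma=\sigma^{[n-1]}\sigma_{[n-1]}$ with $\sigma^{[n-1]}\in T_n$, $\sigma_{[n-1]}\in S_n$. An element $w$ is chessboard if $w(i)\equiv i\pmod 2$ for all $i\in[n]$, or $w(i)\equiv i+1\pmod 2$ for all $i\in[n]$; $\sigma$ is a good chessboard element if $\sigma$, $\sigma^{[n-1]}$ and $\sigma_{[n-1]}$ are all chessboard. $\mathrm{oinv}(w)$ counts pairs $1\le i<j\le n$ with $w(i)>w(j)$ and $j-i$ odd; $\mathrm{onsp}(w)$ counts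 pairs $1\le i<j\le n$ with $w(i)+w(j)<0$ and $j-i$ odd. -}

module Defs where

open import Data.Nat as ℕ using (ℕ; zero; suc; _%_)
open import Data.Nat.Properties as ℕP using ()
open import Data.Integer as ℤ using (ℤ; +_; -[1+_]; ∣_∣; -_)
open import Data.Integer.Properties as ℤP using ()
open import Data.Fin using (Fin; toℕ; fromℕ<)
open import Data.List using (List; length; filter; allFin; cartesianProduct)
open import Data.Product using (_×_; _,_)
open import Data.Sum using () renaming (_⊎_ to _⊎′_)
open import Relation.Binary.PropositionalEquality using (_≡_; _≢_)
open import Relation.Nullary using (Dec; yes; no; ¬_)
open import Relation.Nullary.Decidable using (_×-dec_)

-- A signed permutation of [n] is represented by its window
-- [w(1),...,w(n)], a function Fin n → ℤ (position i : Fin n stands for i+1).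
Window : ℕ → Set
Window n = Fin n → ℤ

-- the window is that of a signed permutation: entries are nonzero, have
-- absolute value ≤ n, and distinct absolute values (hence {|w(i)|} = [n]).
IsSignedPerm : (n : ℕ) → Window n → Set
IsSignedPerm n w =
  (∀ i → w i ≢ + 0) × (∀ i → ∣ w i ∣ ℕ.≤ n) × (∀ i j → ∣ w i ∣ ≡ ∣ w j ∣ → i ≡ j)

negCount : {n : ℕ} → Window n → ℕ
negCount {n} w = length (filter (λ i → w i ℤ.<? + 0) (allFin n))

InD : (n : ℕ) → Window n → Set
InD n w = IsSignedPerm n w × (negCount w % 2 ≡ 0)

InS : (n : ℕ) → Window n → Set
InS n w = InD n w × (∀ i → + 0 ℤ.< w i)

InT : (n : ℕ) → Window n → Set
InT n w = InD n w × (∀ i j → toℕ i ℕ.< toℕ j → w i ℤ.< w j)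

-- extension of a window to the signed map on ℤ: w(-k) = -w(k), w(0) = 0
-- (values outside ±[n] are irrelevant and set to 0)
apply : {n : ℕ} → Window n → ℤ → ℤ
apply {n} w (+ zero) = + 0
apply {n} w (+ suc k) with k ℕP.<? n
... | yes p = w (fromℕ< p)
... | no _ = + 0
apply {n} w -[1+ k ] = - apply w (+ suc k)

_∘ʷ_ : {n : ℕ} → Window n → Window n → Window n
(u ∘ʷ v) i = apply u (v i)

-- chessboard: w(i) ≡ i (mod 2) for all i, or w(i) ≡ i+1 (mod 2) for all i
-- (positions are 1-based: position i : Fin n is the integer toℕ i + 1;
--  parity of an integer is that of its absolute value)
IsChessboard : {n : ℕ} → Window n → Set
IsChessboard {n} w =
  (∀ i → ∣ w i ∣ % 2 ≡ suc (toℕ i) % 2) ⊎′ (∀ i → ∣ w i ∣ % 2 ≡ suc (suc (toℕ i)) % 2)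

oddPair? : {n : ℕ} → (i j : Fin n) → Dec ((toℕ i ℕ.< toℕ j) × ((toℕ j ℕ.∸ toℕ i) % 2 ≡ 1))
oddPair? i j = (toℕ i ℕP.<? toℕ j) ×-dec ((toℕ j ℕ.∸ toℕ i) % 2 ℕP.≟ 1)

oinv : {n : ℕ} → Window n → ℕ
oinv {n} w = length (filter (λ (p : Fin n × Fin n) → let (i , j) = p in
  oddPair? i j ×-dec (w j ℤ.<? w i)) (cartesianProduct (allFin n) (allFin n)))

onsp : {n : ℕ} → Window n → ℕ
onsp {n} w = length (filter (λ (p : Fin n × Fin n) → let (i , j) = p in
  oddPair? i j ×-dec ((w i ℤ.+ w j) ℤ.<? + 0)) (cartesianProduct (allFin n) (allFin n)))

module Submission where

-- Since ρ ∈ S_n has positive entries, ρ(i) = π(i) + 1 for an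
-- injective π : Fin n → Fin n, and σ = τ ρ reads σ(i) = τ(π(i)).
--   * τ ∈ T_n is increasing, so σ(j) < σ(i) ⇔ π(j) < π(i) ⇔ ρ(j) < ρ(i):
--     σ and ρ have the same relative order, hence oinv σ = oinv ρ; and oinv τ = 0.
--   * All entries of ρ are positive, hence onsp ρ = 0.
--   * onsp counts pairs i < j with j - i odd satisfying a SYMMETRIC condition, so
--     twice it counts ORDERED pairs (i, j) with i + j odd.  As ρ is chessboard, π
--     preserves the parity of i + j, and an ordered double sum is invariant under
--     reindexing by the bijection π; hence onsp σ = onsp τ.

open import Defs
open import Data.Nat using (ℕ; _≤_; _+_)
open import Data.Product using (_×_)
open import Relation.Binary.PropositionalEquality using (_≡_)

open import Data.Nat using (zero; suc; _*_; _∸_; _%_; _<_; s≤s)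
import Data.Nat.Properties as ℕP
open import Data.Nat.DivMod using (%-distribˡ-+; [m+kn]%n≡m%n)
open import Data.Nat.ListAction using () renaming (sum to listSum)
open import Data.Nat.ListAction.Properties using () renaming (sum-++ to listSum-++)
open import Data.Nat.Tactic.RingSolver using (solve-∀)
open import Data.Integer as ℤ using (ℤ; +_; ∣_∣; +<+)
import Data.Integer.Properties as ℤP
open import Data.Fin as Fin using (Fin; toℕ; fromℕ<)
import Data.Fin.Properties as FinP
open import Data.Fin.Permutation using (Permutation′; permutation)
open import Data.List as List using ([]; _∷_; length; filter; allFin; cartesianProduct; map)
import Data.List.Properties as ListP
open import Data.Product using (_,_; Σ; ∃; proj₁; proj₂)
open import Data.Sum using (inj₁; inj₂)
open import Data.Empty using (⊥-elim)
open import Function using (_∘_; id)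
open import Relation.Nullary using (Dec; yes; no; ¬_)
open import Relation.Nullary.Decidable using (_×-dec_)
open import Relation.Binary using (tri<; tri≈; tri>)
open import Relation.Binary.PropositionalEquality
  using (_≢_; refl; sym; trans; cong; cong₂; subst₂; module ≡-Reasoning)
open import Algebra.Properties.CommutativeMonoid.Sum ℕP.+-0-commutativeMonoid
  using (sum; sum-syntax; sum-cong-≗; sum-replicate-zero; ∑-distrib-+; ∑-comm; sum-permute)

indicator : ∀ {a} {A : Set a} → Dec A → ℕ
indicator (yes _) = 1
indicator (no _)  = 0

indicator-cong : ∀ {a b} {A : Set a} {B : Set b} (p : Dec A) (q : Dec B) →
  (A → B) → (B → A) → indicator p ≡ indicator q
indicator-cong (yes _) (yes _) _ _ = refl
indicator-cong (no _)  (no _)  _ _ = refl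
indicator-cong (yes a) (no ¬b) f _ = ⊥-elim (¬b (f a))
indicator-cong (no ¬a) (yes b) _ g = ⊥-elim (¬a (g b))

indicator-no : ∀ {a} {A : Set a} (p : Dec A) → ¬ A → indicator p ≡ 0
indicator-no (yes a) ¬a = ⊥-elim (¬a a)
indicator-no (no _)  _  = refl

length-filter≡sum : ∀ {A : Set} {P : A → Set} (P? : ∀ x → Dec (P x)) xs →
  length (filter P? xs) ≡ listSum (map (indicator ∘ P?) xs)
length-filter≡sum P? [] = refl
length-filter≡sum P? (x ∷ xs) with P? x
... | yes _ = cong suc (length-filter≡sum P? xs)
... | no _  = length-filter≡sum P? xs

sum-cartesianProduct : ∀ {A B : Set} (g : A × B → ℕ) xs ys →
  listSum (map g (cartesianProduct xs ys))
    ≡ listSum (map (λ x → listSum (map (λ y → g (x , y)) ys)) xs)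
sum-cartesianProduct g [] ys = refl
sum-cartesianProduct g (x ∷ xs) ys = begin
  listSum (map g (map (x ,_) ys List.++ cartesianProduct xs ys))
    ≡⟨ cong listSum (ListP.map-++ g (map (x ,_) ys) _) ⟩
  listSum (map g (map (x ,_) ys) List.++ map g (cartesianProduct xs ys))
    ≡⟨ listSum-++ (map g (map (x ,_) ys)) _ ⟩
  listSum (map g (map (x ,_) ys)) + listSum (map g (cartesianProduct xs ys))
    ≡⟨ cong₂ _+_ (cong listSum (sym (ListP.map-∘ ys))) (sum-cartesianProduct g xs ys) ⟩
  listSum (map (λ y → g (x , y)) ys)
    + listSum (map (λ x → listSum (map (λ y → g (x , y)) ys)) xs) ∎
  where open ≡-Reasoning

sum-allFin : ∀ {n} (f : Fin n → ℕ) → listSum (map f (allFin n)) ≡ sum f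
sum-allFin {n} f = trans (cong listSum (ListP.map-tabulate id f)) (sum-tabulate f)
  where
  sum-tabulate : ∀ {m} (g : Fin m → ℕ) → listSum (List.tabulate g) ≡ sum g
  sum-tabulate {zero}  g = refl
  sum-tabulate {suc m} g = cong (_+_ (g Fin.zero)) (sum-tabulate (g ∘ Fin.suc))

countPairs : ∀ {n} {P : Fin n × Fin n → Set} (P? : ∀ p → Dec (P p)) →
  length (filter P? (cartesianProduct (allFin n) (allFin n)))
    ≡ ∑[ i < n ] ∑[ j < n ] indicator (P? (i , j))
countPairs {n} P? = begin
  length (filter P? (cartesianProduct (allFin n) (allFin n)))
    ≡⟨ length-filter≡sum P? (cartesianProduct (allFin n) (allFin n)) ⟩
  listSum (map (indicator ∘ P?) (cartesianProduct (allFin n) (allFin n)))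
    ≡⟨ sum-cartesianProduct (indicator ∘ P?) (allFin n) (allFin n) ⟩
  listSum (map (λ i → listSum (map (λ j → indicator (P? (i , j))) (allFin n))) (allFin n))
    ≡⟨ cong listSum (ListP.map-cong (λ i → sum-allFin (λ j → indicator (P? (i , j)))) (allFin n)) ⟩
  listSum (map (λ i → ∑[ j < n ] indicator (P? (i , j))) (allFin n))
    ≡⟨ sum-allFin (λ i → ∑[ j < n ] indicator (P? (i , j))) ⟩
  ∑[ i < n ] ∑[ j < n ] indicator (P? (i , j)) ∎
  where open ≡-Reasoning

sum-zero : ∀ {n} (f : Fin n → ℕ) → (∀ i → f i ≡ 0) → sum f ≡ 0
sum-zero {n} f f≡0 = trans (sum-cong-≗ f≡0) (sum-replicate-zero n)

Injective : ∀ {n} → (Fin n → Fin n) → Set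
Injective {n} f = ∀ {i j} → f i ≡ f j → i ≡ j

injective⇒surjective : ∀ {n} (f : Fin n → Fin n) → Injective f → ∀ y → ∃ λ x → f x ≡ y
injective⇒surjective {suc m} f f-inj y with FinP.any? (λ x → f x FinP.≟ y)
... | yes hit = hit
... | no miss = ⊥-elim (ℕP.<-irrefl refl (FinP.injective⇒≤ g-inj))
  where
  -- if y is missed, deleting it from the codomain gives an injection Fin (1+m) → Fin m
  avoids : ∀ x → y ≢ f x
  avoids x e = miss (x , sym e)
  g : Fin (suc m) → Fin m
  g x = Fin.punchOut (avoids x)
  g-inj : ∀ {i j} → g i ≡ g j → i ≡ j
  g-inj e = f-inj (FinP.punchOut-injective (avoids _) (avoids _) e)

∑∑-reindex : ∀ {n} (π : Fin n → Fin n) → Injective π → (h : Fin n → Fin n → ℕ) →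
  ∑[ i < n ] ∑[ j < n ] h (π i) (π j) ≡ ∑[ i < n ] ∑[ j < n ] h i j
∑∑-reindex {n} π π-inj h =
  trans (sum-cong-≗ (λ i → reindex (h (π i)))) (reindex (λ k → ∑[ j < n ] h k j))
  where
  π⁻¹ : Fin n → Fin n
  π⁻¹ y = proj₁ (injective⇒surjective π π-inj y)
  asPermutation : Permutation′ n
  asPermutation = permutation π π⁻¹ (λ y → proj₂ (injective⇒surjective π π-inj y))
                                   (λ x → π-inj (proj₂ (injective⇒surjective π π-inj (π x))))
  reindex : (f : Fin n → ℕ) → ∑[ i < n ] f (π i) ≡ sum f
  reindex f = sym (sum-permute f asPermutation)

+-pres-≡₂ : ∀ x y a b → x % 2 ≡ a % 2 → y % 2 ≡ b % 2 → (x + y) % 2 ≡ (a + b) % 2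
+-pres-≡₂ x y a b x≡a y≡b = begin
  (x + y) % 2             ≡⟨ %-distribˡ-+ x y 2 ⟩
  (x % 2 + y % 2) % 2     ≡⟨ cong₂ (λ u v → (u + v) % 2) x≡a y≡b ⟩
  (a % 2 + b % 2) % 2     ≡⟨ %-distribˡ-+ a b 2 ⟨
  (a + b) % 2             ∎
  where open ≡-Reasoning

suc+suc-parity : ∀ a b → (suc a + suc b) % 2 ≡ (a + b) % 2
suc+suc-parity a b = trans (cong (_% 2) (shift a b)) ([m+kn]%n≡m%n (a + b) 1 2)
  where
  shift : ∀ a b → suc a + suc b ≡ (a + b) + 1 * 2
  shift = solve-∀

double-even : ∀ a → (a + a) % 2 ≡ 0
double-even a = trans (cong (_% 2) (asMultiple a)) ([m+kn]%n≡m%n 0 a 2)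
  where
  asMultiple : ∀ a → a + a ≡ 0 + a * 2
  asMultiple = solve-∀

-- For a < b, the difference b ∸ a has the parity of a + b (they differ by 2a).
∸-parity : ∀ {a b} → a < b → (b ∸ a) % 2 ≡ (a + b) % 2
∸-parity {a} {b} a<b = begin
  (b ∸ a) % 2               ≡⟨ [m+kn]%n≡m%n (b ∸ a) a 2 ⟨
  ((b ∸ a) + a * 2) % 2     ≡⟨ cong (_% 2) (rearrange a (b ∸ a)) ⟨
  (a + ((b ∸ a) + a)) % 2   ≡⟨ cong (λ z → (a + z) % 2) (ℕP.m∸n+n≡m (ℕP.<⇒≤ a<b)) ⟩
  (a + b) % 2               ∎
  where
  open ≡-Reasoning
  rearrange : ∀ a c → a + (c + a) ≡ c + a * 2
  rearrange = solve-∀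

chessboard-pairParity : ∀ {n} (w : Window n) → IsChessboard w →
  ∀ i j → (∣ w i ∣ + ∣ w j ∣) % 2 ≡ (toℕ i + toℕ j) % 2
chessboard-pairParity w (inj₁ sameParity) i j =
  trans (+-pres-≡₂ ∣ w i ∣ ∣ w j ∣ (suc (toℕ i)) (suc (toℕ j)) (sameParity i) (sameParity j))
        (suc+suc-parity (toℕ i) (toℕ j))
chessboard-pairParity w (inj₂ shiftedParity) i j =
  trans (+-pres-≡₂ ∣ w i ∣ ∣ w j ∣ (suc (suc (toℕ i))) (suc (suc (toℕ j)))
                   (shiftedParity i) (shiftedParity j))
        (trans (suc+suc-parity (suc (toℕ i)) (suc (toℕ j))) (suc+suc-parity (toℕ i) (toℕ j)))

oddPairWith? : ∀ {n} {R : Fin n → Fin n → Set} → (∀ i j → Dec (R i j)) →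
  ∀ i j → Dec (((toℕ i < toℕ j) × ((toℕ j ∸ toℕ i) % 2 ≡ 1)) × R i j)
oddPairWith? R? i j = oddPair? i j ×-dec R? i j

-- oddPairCount R? = #{(i, j) : i < j, j - i odd, R i j}.  Both oinv and onsp
-- are definitionally of this form.
oddPairCount : ∀ {n} {R : Fin n → Fin n → Set} → (∀ i j → Dec (R i j)) → ℕ
oddPairCount {n} R? =
  length (filter (λ p → oddPairWith? R? (proj₁ p) (proj₂ p)) (cartesianProduct (allFin n) (allFin n)))

oddPairCount≡∑∑ : ∀ {n} {R : Fin n → Fin n → Set} (R? : ∀ i j → Dec (R i j)) →
  oddPairCount R? ≡ ∑[ i < n ] ∑[ j < n ] indicator (oddPairWith? R? i j)
oddPairCount≡∑∑ R? = countPairs (λ p → oddPairWith? R? (proj₁ p) (proj₂ p))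

oddPairCount-cong : ∀ {n} {R R′ : Fin n → Fin n → Set}
  (R? : ∀ i j → Dec (R i j)) (R′? : ∀ i j → Dec (R′ i j)) →
  (∀ {i j} → R i j → R′ i j) → (∀ {i j} → R′ i j → R i j) →
  oddPairCount R? ≡ oddPairCount R′?
oddPairCount-cong {n} R? R′? to from = begin
  oddPairCount R?                                            ≡⟨ oddPairCount≡∑∑ R? ⟩
  ∑[ i < n ] ∑[ j < n ] indicator (oddPairWith? R? i j)      ≡⟨ sum-cong-≗ (λ i → sum-cong-≗ (λ j →
    indicator-cong (oddPairWith? R? i j) (oddPairWith? R′? i j)
                   (λ (odd , r) → odd , to r) (λ (odd , r) → odd , from r))) ⟩
  ∑[ i < n ] ∑[ j < n ] indicator (oddPairWith? R′? i j)     ≡⟨ oddPairCount≡∑∑ R′? ⟨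
  oddPairCount R′?                                           ∎
  where open ≡-Reasoning

oddPairCount-zero : ∀ {n} {R : Fin n → Fin n → Set} (R? : ∀ i j → Dec (R i j)) →
  (∀ i j → toℕ i < toℕ j → ¬ R i j) → oddPairCount R? ≡ 0
oddPairCount-zero R? never = trans (oddPairCount≡∑∑ R?) (sum-zero _ (λ i → sum-zero _ (λ j →
  indicator-no (oddPairWith? R? i j) (λ ((i<j , _) , r) → never i j i<j r))))

oddSum? : ∀ {n} (i j : Fin n) → Dec ((toℕ i + toℕ j) % 2 ≡ 1)
oddSum? i j = (toℕ i + toℕ j) % 2 ℕP.≟ 1

module _ {n} {R : Fin n → Fin n → Set} (R? : ∀ i j → Dec (R i j)) where

  oddPair-belowDiagonal : ∀ {i j} → toℕ j ≤ toℕ i → indicator (oddPairWith? R? i j) ≡ 0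
  oddPair-belowDiagonal {i} {j} j≤i =
    indicator-no (oddPairWith? R? i j) (λ ((i<j , _) , _) → ℕP.<⇒≱ i<j j≤i)

  oddSum-aboveDiagonal : ∀ {i j} → toℕ i < toℕ j →
    indicator (oddSum? i j ×-dec R? i j) ≡ indicator (oddPairWith? R? i j)
  oddSum-aboveDiagonal {i} {j} i<j =
    indicator-cong (oddSum? i j ×-dec R? i j) (oddPairWith? R? i j)
    (λ (odd , r) → (i<j , trans (∸-parity i<j) odd) , r)
    (λ ((_ , odd) , r) → trans (sym (∸-parity i<j)) odd , r)

  oddSum-diagonal : ∀ {i j} → toℕ i ≡ toℕ j → indicator (oddSum? i j ×-dec R? i j) ≡ 0
  oddSum-diagonal {i} {j} i≡j = indicator-no (oddSum? i j ×-dec R? i j)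
    (λ (odd , _) → ℕP.0≢1+n (trans (sym diagonalEven) odd))
    where
    diagonalEven : (toℕ i + toℕ j) % 2 ≡ 0
    diagonalEven = trans (cong (λ k → (toℕ i + k) % 2) (sym i≡j)) (double-even (toℕ i))

  oddSum-swap : (∀ {i j} → R i j → R j i) → ∀ i j →
    indicator (oddSum? i j ×-dec R? i j) ≡ indicator (oddSum? j i ×-dec R? j i)
  oddSum-swap R-sym i j = indicator-cong (oddSum? i j ×-dec R? i j) (oddSum? j i ×-dec R? j i)
    (λ (odd , r) → trans swap odd , R-sym r) (λ (odd , r) → trans (sym swap) odd , R-sym r)
    where
    swap : (toℕ j + toℕ i) % 2 ≡ (toℕ i + toℕ j) % 2
    swap = cong (_% 2) (ℕP.+-comm (toℕ j) (toℕ i))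

  oddSum-split : (∀ {i j} → R i j → R j i) → ∀ i j →
    indicator (oddSum? i j ×-dec R? i j)
      ≡ indicator (oddPairWith? R? i j) + indicator (oddPairWith? R? j i)
  oddSum-split R-sym i j with ℕP.<-cmp (toℕ i) (toℕ j)
  ... | tri< i<j _ _ = begin
    indicator (oddSum? i j ×-dec R? i j)    ≡⟨ oddSum-aboveDiagonal i<j ⟩
    indicator (oddPairWith? R? i j)         ≡⟨ ℕP.+-identityʳ _ ⟨
    indicator (oddPairWith? R? i j) + 0
      ≡⟨ cong (_+_ (indicator (oddPairWith? R? i j))) (oddPair-belowDiagonal (ℕP.<⇒≤ i<j)) ⟨
    indicator (oddPairWith? R? i j) + indicator (oddPairWith? R? j i) ∎
    where open ≡-Reasoning
  ... | tri≈ _ i≡j _ = begin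
    indicator (oddSum? i j ×-dec R? i j)    ≡⟨ oddSum-diagonal i≡j ⟩
    0 + 0
      ≡⟨ cong₂ _+_ (oddPair-belowDiagonal (ℕP.≤-reflexive (sym i≡j)))
                   (oddPair-belowDiagonal (ℕP.≤-reflexive i≡j)) ⟨
    indicator (oddPairWith? R? i j) + indicator (oddPairWith? R? j i) ∎
    where open ≡-Reasoning
  ... | tri> _ _ j<i = begin
    indicator (oddSum? i j ×-dec R? i j)    ≡⟨ oddSum-swap R-sym i j ⟩
    indicator (oddSum? j i ×-dec R? j i)    ≡⟨ oddSum-aboveDiagonal j<i ⟩
    indicator (oddPairWith? R? j i)
      ≡⟨ cong (_+ indicator (oddPairWith? R? j i)) (oddPair-belowDiagonal (ℕP.<⇒≤ j<i)) ⟨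
    indicator (oddPairWith? R? i j) + indicator (oddPairWith? R? j i) ∎
    where open ≡-Reasoning

  oddPairCount-double : (∀ {i j} → R i j → R j i) →
    2 * oddPairCount R? ≡ ∑[ i < n ] ∑[ j < n ] indicator (oddSum? i j ×-dec R? i j)
  oddPairCount-double R-sym = begin
    2 * oddPairCount R?                              ≡⟨ cong (2 *_) (oddPairCount≡∑∑ R?) ⟩
    2 * (∑[ i < n ] ∑[ j < n ] odd i j)              ≡⟨ cong (_+_ (∑[ i < n ] ∑[ j < n ] odd i j))
                                                             (ℕP.+-identityʳ _) ⟩
    ∑[ i < n ] ∑[ j < n ] odd i j + ∑[ i < n ] ∑[ j < n ] odd i j
      ≡⟨ cong (_+_ (∑[ i < n ] ∑[ j < n ] odd i j)) (∑-comm (λ i j → odd j i)) ⟨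
    ∑[ i < n ] ∑[ j < n ] odd i j + ∑[ i < n ] ∑[ j < n ] odd j i
      ≡⟨ ∑-distrib-+ (λ i → ∑[ j < n ] odd i j) (λ i → ∑[ j < n ] odd j i) ⟨
    ∑[ i < n ] (∑[ j < n ] odd i j + ∑[ j < n ] odd j i)
      ≡⟨ sum-cong-≗ (λ i → ∑-distrib-+ (odd i) (λ j → odd j i)) ⟨
    ∑[ i < n ] ∑[ j < n ] (odd i j + odd j i)
      ≡⟨ sum-cong-≗ (λ i → sum-cong-≗ (λ j → oddSum-split R-sym i j)) ⟨
    ∑[ i < n ] ∑[ j < n ] indicator (oddSum? i j ×-dec R? i j) ∎
    where
    open ≡-Reasoning
    odd : Fin n → Fin n → ℕ
    odd i j = indicator (oddPairWith? R? i j)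

Increasing : ∀ {n} → Window n → Set
Increasing τ = ∀ i j → toℕ i < toℕ j → τ i ℤ.< τ j

SameOrder : ∀ {n} → Window n → Window n → Set
SameOrder σ ρ = (∀ {i j} → σ j ℤ.< σ i → ρ j ℤ.< ρ i) × (∀ {i j} → ρ j ℤ.< ρ i → σ j ℤ.< σ i)

oinv-sameOrder : ∀ {n} (σ ρ : Window n) → SameOrder σ ρ → oinv σ ≡ oinv ρ
oinv-sameOrder σ ρ (to , from) =
  oddPairCount-cong (λ i j → σ j ℤ.<? σ i) (λ i j → ρ j ℤ.<? ρ i) to from

oinv-increasing : ∀ {n} (τ : Window n) → Increasing τ → oinv τ ≡ 0
oinv-increasing τ increasing = oddPairCount-zero (λ i j → τ j ℤ.<? τ i)
  (λ i j i<j τj<τi → ℤP.<-asym τj<τi (increasing i j i<j))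

onsp-positive : ∀ {n} (ρ : Window n) → (∀ i → + 0 ℤ.< ρ i) → onsp ρ ≡ 0
onsp-positive ρ positive = oddPairCount-zero (λ i j → (ρ i ℤ.+ ρ j) ℤ.<? + 0)
  (λ i j _ negative → ℤP.<-asym negative (ℤP.+-mono-< (positive i) (positive j)))

-- onsp is invariant under reindexing the window by an injection π that
-- preserves the parity of i + j: count ordered pairs via the doubling lemma.
onsp-reindex : ∀ {n} (σ τ : Window n) (π : Fin n → Fin n) → Injective π →
  (∀ i j → (toℕ (π i) + toℕ (π j)) % 2 ≡ (toℕ i + toℕ j) % 2) →
  (∀ i → σ i ≡ τ (π i)) → onsp σ ≡ onsp τ
onsp-reindex {n} σ τ π π-inj π-parity σ≡τπ = ℕP.*-cancelˡ-≡ (onsp σ) (onsp τ) 2 (begin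
  2 * onsp σ                                     ≡⟨ oddPairCount-double (negative? σ) (symmetric σ) ⟩
  ∑[ i < n ] ∑[ j < n ] oddNegative σ i j        ≡⟨ sum-cong-≗ (sum-cong-≗ ∘ transport) ⟩
  ∑[ i < n ] ∑[ j < n ] oddNegative τ (π i) (π j) ≡⟨ ∑∑-reindex π π-inj (oddNegative τ) ⟩
  ∑[ i < n ] ∑[ j < n ] oddNegative τ i j        ≡⟨ oddPairCount-double (negative? τ) (symmetric τ) ⟨
  2 * onsp τ                                     ∎)
  where
  open ≡-Reasoning
  NegativeSum : ℤ → ℤ → Set
  NegativeSum a b = (a ℤ.+ b) ℤ.< + 0
  negative? : (w : Window n) (i j : Fin n) → Dec (NegativeSum (w i) (w j))
  negative? w i j = (w i ℤ.+ w j) ℤ.<? + 0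
  symmetric : (w : Window n) → ∀ {i j} → NegativeSum (w i) (w j) → NegativeSum (w j) (w i)
  symmetric w {i} {j} = subst₂ ℤ._<_ (ℤP.+-comm (w i) (w j)) refl
  oddNegative : Window n → Fin n → Fin n → ℕ
  oddNegative w i j = indicator (oddSum? i j ×-dec negative? w i j)
  transport : ∀ i j → oddNegative σ i j ≡ oddNegative τ (π i) (π j)
  transport i j = indicator-cong (oddSum? i j ×-dec negative? σ i j)
                                 (oddSum? (π i) (π j) ×-dec negative? τ (π i) (π j))
    (λ (odd , neg) → trans (π-parity i j) odd , subst₂ NegativeSum (σ≡τπ i) (σ≡τπ j) neg)
    (λ (odd , neg) → trans (sym (π-parity i j)) odd ,
                     subst₂ NegativeSum (sym (σ≡τπ i)) (sym (σ≡τπ j)) neg)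

positiveBelow⇒position : ∀ {n} (z : ℤ) → + 0 ℤ.< z → ∣ z ∣ ≤ n →
  Σ (Fin n) λ k → z ≡ + suc (toℕ k)
positiveBelow⇒position (+ zero)  (+<+ ()) _
positiveBelow⇒position (+ suc k) _ k<n =
  fromℕ< k<n , cong (λ m → + suc m) (sym (FinP.toℕ-fromℕ< k<n))

apply-position : ∀ {n} (w : Window n) (k : Fin n) → apply w (+ suc (toℕ k)) ≡ w k
apply-position {n} w k with toℕ k ℕP.<? n
... | yes k<n = cong w (FinP.fromℕ<-toℕ k k<n)
... | no k≮n  = ⊥-elim (k≮n (FinP.toℕ<n k))

module _ {n} {ρ : Window n} (ρ∈S : InS n ρ) where

  private
    positionOf : ∀ i → Σ (Fin n) λ k → ρ i ≡ + suc (toℕ k)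
    positionOf i =
      positiveBelow⇒position (ρ i) (proj₂ ρ∈S i) (proj₁ (proj₂ (proj₁ (proj₁ ρ∈S))) i)

  position : Fin n → Fin n
  position i = proj₁ (positionOf i)

  position-spec : ∀ i → ρ i ≡ + suc (toℕ (position i))
  position-spec i = proj₂ (positionOf i)

  position-injective : Injective position
  position-injective {i} {j} πi≡πj = proj₂ (proj₂ (proj₁ (proj₁ ρ∈S))) i j (begin
    ∣ ρ i ∣                  ≡⟨ cong ∣_∣ (position-spec i) ⟩
    suc (toℕ (position i))   ≡⟨ cong (suc ∘ toℕ) πi≡πj ⟩
    suc (toℕ (position j))   ≡⟨ cong ∣_∣ (position-spec j) ⟨
    ∣ ρ j ∣                  ∎)
    where open ≡-Reasoning

  composition-position : ∀ {σ τ : Window n} → (∀ i → σ i ≡ (τ ∘ʷ ρ) i) →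
    ∀ i → σ i ≡ τ (position i)
  composition-position {σ} {τ} σ≡τρ i =
    trans (σ≡τρ i) (trans (cong (apply τ) (position-spec i)) (apply-position τ (position i)))

  position-parity : IsChessboard ρ →
    ∀ i j → (toℕ (position i) + toℕ (position j)) % 2 ≡ (toℕ i + toℕ j) % 2
  position-parity chessboard i j = begin
    (toℕ (position i) + toℕ (position j)) % 2
      ≡⟨ suc+suc-parity (toℕ (position i)) (toℕ (position j)) ⟨
    (suc (toℕ (position i)) + suc (toℕ (position j))) % 2
      ≡⟨ cong₂ (λ a b → (∣ a ∣ + ∣ b ∣) % 2) (position-spec i) (position-spec j) ⟨
    (∣ ρ i ∣ + ∣ ρ j ∣) % 2
      ≡⟨ chessboard-pairParity ρ chessboard i j ⟩
    (toℕ i + toℕ j) % 2 ∎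
    where open ≡-Reasoning

  composition-sameOrder : ∀ {σ τ : Window n} → Increasing τ → (∀ i → σ i ≡ (τ ∘ʷ ρ) i) →
    SameOrder σ ρ
  composition-sameOrder {σ} {τ} increasing σ≡τρ = toρ , toσ
    where
    σ≡τπ : ∀ i → σ i ≡ τ (position i)
    σ≡τπ = composition-position σ≡τρ
    reflects : ∀ a b → τ a ℤ.< τ b → toℕ a < toℕ b
    reflects a b τa<τb with ℕP.<-cmp (toℕ a) (toℕ b)
    ... | tri< a<b _ _ = a<b
    ... | tri≈ _ a≡b _ = ⊥-elim (ℤP.<-irrefl (cong τ (FinP.toℕ-injective a≡b)) τa<τb)
    ... | tri> _ _ b<a = ⊥-elim (ℤP.<-asym τa<τb (increasing b a b<a))
    toρ : ∀ {i j} → σ j ℤ.< σ i → ρ j ℤ.< ρ i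
    toρ {i} {j} σj<σi = subst₂ ℤ._<_ (sym (position-spec j)) (sym (position-spec i))
      (+<+ (s≤s (reflects (position j) (position i) (subst₂ ℤ._<_ (σ≡τπ j) (σ≡τπ i) σj<σi))))
    toσ : ∀ {i j} → ρ j ℤ.< ρ i → σ j ℤ.< σ i
    toσ {i} {j} ρj<ρi with subst₂ ℤ._<_ (position-spec j) (position-spec i) ρj<ρi
    ... | +<+ (s≤s πj<πi) =
      subst₂ ℤ._<_ (sym (σ≡τπ j)) (sym (σ≡τπ i)) (increasing (position j) (position i) πj<πi)

mainTheorem14 : (n : ℕ) → 2 ≤ n → (σ τ ρ : Window n) →
    InD n σ → InT n τ → InS n ρ → (∀ i → σ i ≡ (τ ∘ʷ ρ) i) →
    IsChessboard σ → IsChessboard τ → IsChessboard ρ →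
    (oinv σ ≡ oinv τ + oinv ρ) × (onsp σ ≡ onsp τ + onsp ρ)
mainTheorem14 n _ σ τ ρ _ τ∈T ρ∈S σ≡τρ _ _ ρ-chessboard = oinv-additive , onsp-additive
  where
  open ≡-Reasoning

  oinv-additive : oinv σ ≡ oinv τ + oinv ρ
  oinv-additive = begin
    oinv σ          ≡⟨ oinv-sameOrder σ ρ (composition-sameOrder ρ∈S (proj₂ τ∈T) σ≡τρ) ⟩
    oinv ρ          ≡⟨ cong (_+ oinv ρ) (oinv-increasing τ (proj₂ τ∈T)) ⟨
    oinv τ + oinv ρ ∎

  onsp-additive : onsp σ ≡ onsp τ + onsp ρ
  onsp-additive = begin
    onsp σ          ≡⟨ onsp-reindex σ τ (position ρ∈S) (position-injective ρ∈S)
                         (position-parity ρ∈S ρ-chessboard) (composition-position ρ∈S σ≡τρ) ⟩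
    onsp τ          ≡⟨ ℕP.+-identityʳ (onsp τ) ⟨
    onsp τ + 0      ≡⟨ cong (_+_ (onsp τ)) (onsp-positive ρ (proj₂ ρ∈S)) ⟨
    onsp τ + onsp ρ ∎
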